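{- If $B$ is a regular board in the hexagonal grid, then $x(B) = f(B)$.
   Context: The hexagonal grid is the tiling of the plane by congruent regular hexagons (cells); two cells are neighbors if they share an edge. A board is a finite set $B$ of cells such that every cell of $B$ has at least one neighbor in $B$. A board $B$ is regular if for any two cells of $B$ that have a common neighbor in the grid, at least one of their common neighbors belongs to $B$. A fragment is a cell $c$ together with a nonempty subset of its six neighbors; a maximal fragment is a cell together with all six of its neighbors. $x(B)$ is the minimal number of maximal fragments (placed in the grid) whose union contains $B$; they may overlap each other and may contain cells outside $B$. $f(B)$ is the minimum number of fragments in a partition of $B$ into fragments each contained in $B$. -}

module Defs where

open import Data.Nat using (ℕ; _≤_)
open import Data.Integer using (ℤ; +_; -[1+_]; _-_)
open import Data.Product using (_×_; _,_; Σ; ∃; ∃-syntax)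
open import Data.Sum using (_⊎_)
open import Data.List using (List; []; _∷_; length; concat; map)
open import Data.List.Membership.Propositional using (_∈_)
open import Data.List.Relation.Unary.All using (All)
open import Data.List.Relation.Unary.Unique.Propositional using (Unique)
open import Relation.Binary.PropositionalEquality using (_≡_; _≢_)

-- Hexagonal grid in axial coordinates: a cell is a pair of integers (q , r).
Cell : Set
Cell = ℤ × ℤ

dirs : List Cell
dirs = (+ 1 , + 0) ∷ (-[1+ 0 ] , + 0) ∷ (+ 0 , + 1) ∷ (+ 0 , -[1+ 0 ])
     ∷ (+ 1 , -[1+ 0 ]) ∷ (-[1+ 0 ] , + 1) ∷ []

Adj : Cell → Cell → Set
Adj (a₁ , a₂) (b₁ , b₂) = (b₁ - a₁ , b₂ - a₂) ∈ dirs

-- A finite set of cells is represented by a list (set = its membership).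
-- A board: every cell of B has a neighbour in B.
IsBoard : List Cell → Set
IsBoard B = ∀ c → c ∈ B → ∃[ d ] (d ∈ B × Adj c d)

IsRegular : List Cell → Set
IsRegular B = ∀ a b → a ∈ B → b ∈ B → a ≢ b →
  ∃[ c ] (Adj a c × Adj b c) → ∃[ c ] (Adj a c × Adj b c × c ∈ B)

InMaxFragment : Cell → Cell → Set
InMaxFragment m c = c ≡ m ⊎ Adj m c

MaxCover : List Cell → List Cell → Set
MaxCover B centres = ∀ c → c ∈ B → ∃[ m ] (m ∈ centres × InMaxFragment m c)

IsX : List Cell → ℕ → Set
IsX B n = (∃[ cs ] (MaxCover B cs × length cs ≡ n))
        × (∀ cs → MaxCover B cs → n ≤ length cs)

-- A fragment: a centre together with a nonempty list of its neighbours.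
record Fragment : Set where
  constructor frag
  field
    centre : Cell
    leaf₀  : Cell
    leaves : List Cell
    adj₀   : Adj centre leaf₀
    adjs   : All (Adj centre) leaves

fragCells : Fragment → List Cell
fragCells (frag c l ls _ _) = c ∷ l ∷ ls

IsFragPartition : List Cell → List Fragment → Set
IsFragPartition B fs =
  Unique (concat (map fragCells fs))
  × (∀ c → c ∈ concat (map fragCells fs) → c ∈ B)
  × (∀ c → c ∈ B → c ∈ concat (map fragCells fs))

IsF : List Cell → ℕ → Set
IsF B n = (∃[ fs ] (IsFragPartition B fs × length fs ≡ n))
        × (∀ fs → IsFragPartition B fs → n ≤ length fs)

-- A partition of B into f fragments gives a cover by f maximal fragments, so x(B) ≤ f(B).
-- Conversely, start from a cover by maximal fragments. A centre m outside B can be replaced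
-- by a centre inside B, or dropped: by regularity, the neighbours of m lying in B contain no
-- two opposite cells and fill every one-cell gap between two of them, so they lie on an arc
-- of at most three consecutive neighbours, all inside the maximal fragment of the middle one.
-- Once the centres lie in B, assigning every other cell of B to an adjacent centre partitions
-- B into stars; a star without leaves has a neighbour in B, and merging it with the star of
-- that neighbour does not increase the number of stars. Hence f(B) ≤ x(B), and both equal the
-- least size of a cover by maximal fragments centred in B, which is found by enumeration.

module Submission where

open import Defs
open import Data.Nat using (ℕ; zero; suc; _+_; _≤_; _<_; z≤n; s≤s)
import Data.Nat.Properties as ℕ
open import Data.Nat.Induction using (<-wellFounded)
open import Data.Nat.ListAction using (sum)
open import Data.Nat.ListAction.Properties using (sum-++; sum-↭)
open import Data.Integer as ℤ using (+_)
import Data.Integer.Properties as ℤ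
open import Data.Integer.Tactic.RingSolver using (solve-∀)
open import Data.Product using (_×_; ∃-syntax; _,_; proj₁; proj₂)
open import Data.Product.Properties using (≡-dec)
open import Data.Sum using (_⊎_; inj₁; inj₂; [_,_]′)
open import Data.List using (List; []; _∷_; _++_; length; concat; map; filter; deduplicate)
import Data.List.Properties as List
open import Data.List.Membership.Propositional using (_∈_; _∉_; find; lose)
open import Data.List.Membership.Propositional.Properties
  using (∈-map⁺; ∈-map⁻; ∈-++⁺ˡ; ∈-++⁺ʳ; ∈-++⁻; ∈-concat⁻′; ∈-concat⁺′; ∈-filter⁺; ∈-filter⁻;
         ∈-deduplicate⁺; ∈-deduplicate⁻; ∈-∃++)
open import Data.List.Relation.Unary.Any using (Any; here; there; any?)
open import Data.List.Relation.Unary.All as All using (All; []; _∷_)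
import Data.List.Relation.Unary.All.Properties as All
open import Data.List.Relation.Unary.Unique.Propositional using (Unique)
import Data.List.Relation.Unary.Unique.Propositional.Properties as Unique
import Data.List.Relation.Unary.Unique.DecPropositional.Properties as Unique
open import Data.List.Relation.Binary.Permutation.Propositional
  using (_↭_; prep; swap; ↭-refl; ↭-sym; ↭-trans; ↭-reflexive; ↭⇒↭ₛ; ↭ₛ⇒↭; module PermutationReasoning)
import Data.List.Relation.Binary.Permutation.Propositional.Properties as ↭
import Data.List.Relation.Binary.Permutation.Setoid.Properties as ↭ₛ
open import Data.Empty using (⊥-elim)
open import Function using (_∘_)
open import Induction.WellFounded using (Acc; acc)
open import Relation.Binary.Definitions using (DecidableEquality)
open import Relation.Binary.PropositionalEquality
  using (_≡_; _≢_; refl; sym; trans; cong; cong₂; subst; setoid; module ≡-Reasoning)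
open import Relation.Nullary using (¬_; Dec; yes; no)
open import Relation.Nullary.Decidable using (True; toWitness; toWitnessFalse; ¬?; _⊎-dec_; _→-dec_; map′)

infixl 6 _⊕_ _⊖_
infix 4 _≟ᶜ_

_⊕_ _⊖_ : Cell → Cell → Cell
(a₁ , a₂) ⊕ (b₁ , b₂) = a₁ ℤ.+ b₁ , a₂ ℤ.+ b₂
(a₁ , a₂) ⊖ (b₁ , b₂) = a₁ ℤ.- b₁ , a₂ ℤ.- b₂

origin : Cell
origin = + 0 , + 0

_≟ᶜ_ : DecidableEquality Cell
_≟ᶜ_ = ≡-dec ℤ._≟_ ℤ._≟_

open import Data.List.Membership.DecPropositional _≟ᶜ_ using (_∈?_)

adj? : ∀ a b → Dec (Adj a b)
adj? a b = b ⊖ a ∈? dirs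

⊕-identityʳ : ∀ a → a ⊕ origin ≡ a
⊕-identityʳ (a₁ , a₂) = cong₂ _,_ (ℤ.+-identityʳ a₁) (ℤ.+-identityʳ a₂)

⊕-assoc : ∀ a b c → (a ⊕ b) ⊕ c ≡ a ⊕ (b ⊕ c)
⊕-assoc (a₁ , a₂) (b₁ , b₂) (c₁ , c₂) = cong₂ _,_ (ℤ.+-assoc a₁ b₁ c₁) (ℤ.+-assoc a₂ b₂ c₂)

⊕-⊖-cancelˡ : ∀ m a b → (m ⊕ b) ⊖ (m ⊕ a) ≡ b ⊖ a
⊕-⊖-cancelˡ (m₁ , m₂) (a₁ , a₂) (b₁ , b₂) = cong₂ _,_ (cancel m₁ a₁ b₁) (cancel m₂ a₂ b₂)
  where
  cancel : ∀ m a b → (m ℤ.+ b) ℤ.- (m ℤ.+ a) ≡ b ℤ.- a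
  cancel = solve-∀

⊕-⊖-cancelʳ : ∀ a d → (a ⊕ d) ⊖ a ≡ d
⊕-⊖-cancelʳ (a₁ , a₂) (d₁ , d₂) = cong₂ _,_ (cancel a₁ d₁) (cancel a₂ d₂)
  where
  cancel : ∀ a d → (a ℤ.+ d) ℤ.- a ≡ d
  cancel = solve-∀

⊖-⊕-inverse : ∀ a b → b ≡ a ⊕ (b ⊖ a)
⊖-⊕-inverse (a₁ , a₂) (b₁ , b₂) = cong₂ _,_ (inverse a₁ b₁) (inverse a₂ b₂)
  where
  inverse : ∀ a b → b ≡ a ℤ.+ (b ℤ.- a)
  inverse = solve-∀

⊖-antisym : ∀ a b → a ⊖ b ≡ origin ⊖ (b ⊖ a)
⊖-antisym (a₁ , a₂) (b₁ , b₂) = cong₂ _,_ (antisym a₁ b₁) (antisym a₂ b₂)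
  where
  antisym : ∀ a b → a ℤ.- b ≡ + 0 ℤ.- (b ℤ.- a)
  antisym = solve-∀

⊖-self : ∀ a → a ⊖ a ≡ origin
⊖-self (a₁ , a₂) = cong₂ _,_ (self a₁) (self a₂)
  where
  self : ∀ a → a ℤ.- a ≡ + 0
  self = solve-∀

⊕-cancelˡ : ∀ m {a b} → m ⊕ a ≡ m ⊕ b → a ≡ b
⊕-cancelˡ m {a} {b} eq = begin
  a             ≡⟨ sym (⊕-⊖-cancelʳ m a) ⟩
  (m ⊕ a) ⊖ m   ≡⟨ cong (_⊖ m) eq ⟩
  (m ⊕ b) ⊖ m   ≡⟨ ⊕-⊖-cancelʳ m b ⟩
  b             ∎
  where open ≡-Reasoning

Adj-⊕⁺ : ∀ m {a b} → Adj a b → Adj (m ⊕ a) (m ⊕ b)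
Adj-⊕⁺ m {a} {b} = subst (_∈ dirs) (sym (⊕-⊖-cancelˡ m a b))

Adj-⊕⁻ : ∀ m {a b} → Adj (m ⊕ a) (m ⊕ b) → Adj a b
Adj-⊕⁻ m {a} {b} = subst (_∈ dirs) (⊕-⊖-cancelˡ m a b)

Adj-dir : ∀ a {d} → d ∈ dirs → Adj a (a ⊕ d)
Adj-dir a {d} = subst (_∈ dirs) (sym (⊕-⊖-cancelʳ a d))

Adj-decompose : ∀ a b → Adj a b → ∃[ d ] (d ∈ dirs × b ≡ a ⊕ d)
Adj-decompose a b adj = b ⊖ a , adj , ⊖-⊕-inverse a b

-- Proofs by evaluation: the decision procedure is run on all directions during type checking.
all-dirs : {P : Cell → Set} (P? : ∀ d → Dec (P d)) → {True (All.all? P? dirs)} →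
           ∀ {d} → d ∈ dirs → P d
all-dirs P? {holds} = All.lookup (toWitness holds)

all-dirs² : {P : Cell → Cell → Set} (P? : ∀ d e → Dec (P d e)) →
            {True (All.all? (λ d → All.all? (P? d) dirs) dirs)} →
            ∀ {d e} → d ∈ dirs → e ∈ dirs → P d e
all-dirs² P? {holds} d∈ = All.lookup (All.lookup (toWitness holds) d∈)

-- Rotation by 60° about the origin in axial coordinates.
rot : Cell → Cell
rot (q , r) = ℤ.- r , q ℤ.+ r

infixr 7 _↻_

_↻_ : ℕ → Cell → Cell
zero  ↻ d = d
suc k ↻ d = rot (k ↻ d)

orbit : Cell → List Cell
orbit d = d ∷ 1 ↻ d ∷ 2 ↻ d ∷ 3 ↻ d ∷ 4 ↻ d ∷ 5 ↻ d ∷ []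

-- Abstract, so that the huge normal forms of these evidence terms are never unfolded
-- (for instance by with-abstraction) where they are used.
abstract
  neg-∈-dirs : ∀ {d} → d ∈ dirs → origin ⊖ d ∈ dirs
  neg-∈-dirs = all-dirs (λ d → origin ⊖ d ∈? dirs)

  origin∉dirs : origin ∉ dirs
  origin∉dirs = toWitnessFalse {a? = origin ∈? dirs} _

  rot-∈-dirs : ∀ {d} → d ∈ dirs → rot d ∈ dirs
  rot-∈-dirs = all-dirs (λ d → rot d ∈? dirs)

  ↻-period : ∀ {d} → d ∈ dirs → 6 ↻ d ≡ d
  ↻-period = all-dirs (λ d → 6 ↻ d ≟ᶜ d)

  ∈-orbit : ∀ {d e} → d ∈ dirs → e ∈ dirs → e ∈ orbit d
  ∈-orbit = all-dirs² (λ d e → e ∈? orbit d)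

  Adj-↻¹ : ∀ {d} → d ∈ dirs → Adj d (1 ↻ d)
  Adj-↻¹ = all-dirs (λ d → adj? d (1 ↻ d))

  Adj-↻⁵ : ∀ {d} → d ∈ dirs → Adj d (5 ↻ d)
  Adj-↻⁵ = all-dirs (λ d → adj? d (5 ↻ d))

  ↻²-distinct : ∀ {d} → d ∈ dirs → d ≢ 2 ↻ d
  ↻²-distinct = all-dirs (λ d → ¬? (d ≟ᶜ 2 ↻ d))

  ↻³-distinct : ∀ {d} → d ∈ dirs → d ≢ 3 ↻ d
  ↻³-distinct = all-dirs (λ d → ¬? (d ≟ᶜ 3 ↻ d))

  common-neighbour-↻² : ∀ {d e} → d ∈ dirs → e ∈ dirs → Adj (2 ↻ d) (d ⊕ e) →
                        d ⊕ e ≡ origin ⊎ d ⊕ e ≡ 1 ↻ d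
  common-neighbour-↻² =
    all-dirs² (λ d e → adj? (2 ↻ d) (d ⊕ e) →-dec ((d ⊕ e ≟ᶜ origin) ⊎-dec (d ⊕ e ≟ᶜ 1 ↻ d)))

  common-neighbour-↻³ : ∀ {d e} → d ∈ dirs → e ∈ dirs → Adj (3 ↻ d) (d ⊕ e) → d ⊕ e ≡ origin
  common-neighbour-↻³ = all-dirs² (λ d e → adj? (3 ↻ d) (d ⊕ e) →-dec (d ⊕ e ≟ᶜ origin))

↻-∈-dirs : ∀ k {d} → d ∈ dirs → k ↻ d ∈ dirs
↻-∈-dirs zero    d∈ = d∈
↻-∈-dirs (suc k) d∈ = rot-∈-dirs (↻-∈-dirs k d∈)

Adj-sym : ∀ a b → Adj a b → Adj b a
Adj-sym a b adj = subst (_∈ dirs) (sym (⊖-antisym a b)) (neg-∈-dirs adj)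

Adj-irrefl : ∀ a → ¬ Adj a a
Adj-irrefl a = subst (_∉ dirs) (sym (⊖-self a)) origin∉dirs

-- Moving centres into a regular board

Misses : List Cell → Cell → Set
Misses B m = ∀ x → x ∈ B → ¬ InMaxFragment m x

Absorbs : List Cell → Cell → Cell → Set
Absorbs B c m = ∀ x → x ∈ B → InMaxFragment m x → InMaxFragment c x

module AroundNonBoardCell (B : List Cell) (regular : IsRegular B) (m : Cell) (m∉B : m ∉ B) where

  Occupied : Cell → Set
  Occupied d = m ⊕ d ∈ B

  occupied? : ∀ d → Dec (Occupied d)
  occupied? d = m ⊕ d ∈? B

  origin-unoccupied : ¬ Occupied origin
  origin-unoccupied = m∉B ∘ subst (_∈ B) (⊕-identityʳ m)

  common-occupied : ∀ {d d′} → d ∈ dirs → d′ ∈ dirs → d ≢ d′ → Occupied d → Occupied d′ →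
                    ∃[ e ] (e ∈ dirs × Adj d′ (d ⊕ e) × Occupied (d ⊕ e))
  common-occupied {d} {d′} d∈ d′∈ d≢d′ d-occ d′-occ
    with regular (m ⊕ d) (m ⊕ d′) d-occ d′-occ (d≢d′ ∘ ⊕-cancelˡ m)
                 (m , Adj-sym m _ (Adj-dir m d∈) , Adj-sym m _ (Adj-dir m d′∈))
  ... | c , adj , adj′ , c∈B with Adj-decompose (m ⊕ d) c adj
  ...   | e , e∈ , refl =
    e , e∈ , Adj-⊕⁻ m {d′} (subst (Adj (m ⊕ d′)) (⊕-assoc m d e) adj′) , subst (_∈ B) (⊕-assoc m d e) c∈B

  opposite-unoccupied : ∀ {d} → d ∈ dirs → Occupied d → ¬ Occupied (3 ↻ d)
  opposite-unoccupied {d} d∈ d-occ d³-occ =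
    let e , e∈ , adj , occ = common-occupied {d} {3 ↻ d} d∈ (↻-∈-dirs 3 d∈) (↻³-distinct d∈) d-occ d³-occ
    in origin-unoccupied (subst Occupied (common-neighbour-↻³ d∈ e∈ adj) occ)

  gap-occupied : ∀ {d} → d ∈ dirs → Occupied d → Occupied (2 ↻ d) → Occupied (1 ↻ d)
  gap-occupied {d} d∈ d-occ d²-occ =
    let e , e∈ , adj , occ = common-occupied {d} {2 ↻ d} d∈ (↻-∈-dirs 2 d∈) (↻²-distinct d∈) d-occ d²-occ
    in [ (λ eq → ⊥-elim (origin-unoccupied (subst Occupied eq occ))) , (λ eq → subst Occupied eq occ) ]′
         (common-neighbour-↻² d∈ e∈ adj)

  Near : Cell → Cell → Set
  Near c e = e ≡ c ⊎ Adj c e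

  ArcCentre : Set
  ArcCentre = ∃[ c ] (c ∈ dirs × Occupied c × ∀ {e} → e ∈ dirs → Occupied e → Near c e)

  arc-centre-by-gaps : ∀ {c} → c ∈ dirs → Occupied c → ¬ Occupied (2 ↻ c) → ¬ Occupied (4 ↻ c) →
                       ArcCentre
  arc-centre-by-gaps {c} c∈ c-occ ¬c² ¬c⁴ = c , c∈ , c-occ , near
    where
    near : ∀ {e} → e ∈ dirs → Occupied e → Near c e
    near e∈ e-occ with ∈-orbit c∈ e∈
    ... | here refl                                         = inj₁ refl
    ... | there (here refl)                                 = inj₂ (Adj-↻¹ c∈)
    ... | there (there (here refl))                         = ⊥-elim (¬c² e-occ)
    ... | there (there (there (here refl)))                 = ⊥-elim (opposite-unoccupied c∈ c-occ e-occ)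
    ... | there (there (there (there (here refl))))         = ⊥-elim (¬c⁴ e-occ)
    ... | there (there (there (there (there (here refl))))) = inj₂ (Adj-↻⁵ c∈)

  -- The centre is d or the neighbour of d on the side where the arc continues.
  find-arc-centre : ∀ {d} → d ∈ dirs → Occupied d → ArcCentre
  find-arc-centre {d} d∈ d-occ with occupied? (1 ↻ d) | occupied? (5 ↻ d)
  ... | yes d¹-occ | yes d⁵-occ = arc-centre-by-gaps d∈ d-occ
    (λ d²-occ → opposite-unoccupied (↻-∈-dirs 2 d∈) d²-occ d⁵-occ)
    (opposite-unoccupied (↻-∈-dirs 1 d∈) d¹-occ)
  ... | yes d¹-occ | no ¬d⁵ with occupied? (2 ↻ d)
  ...   | yes d²-occ = arc-centre-by-gaps (↻-∈-dirs 1 d∈) d¹-occ (opposite-unoccupied d∈ d-occ) ¬d⁵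
  ...   | no ¬d²     = arc-centre-by-gaps d∈ d-occ ¬d² (opposite-unoccupied (↻-∈-dirs 1 d∈) d¹-occ)
  find-arc-centre {d} d∈ d-occ | no ¬d¹ | yes d⁵-occ with occupied? (4 ↻ d)
  ...   | yes d⁴-occ = arc-centre-by-gaps (↻-∈-dirs 5 d∈) d⁵-occ
    (¬d¹ ∘ subst Occupied (↻-period (↻-∈-dirs 1 d∈)))
    (opposite-unoccupied d∈ d-occ ∘ subst Occupied (↻-period (↻-∈-dirs 3 d∈)))
  ...   | no ¬d⁴     = arc-centre-by-gaps d∈ d-occ
    (λ d²-occ → opposite-unoccupied (↻-∈-dirs 2 d∈) d²-occ d⁵-occ) ¬d⁴
  find-arc-centre {d} d∈ d-occ | no ¬d¹ | no ¬d⁵ = arc-centre-by-gaps d∈ d-occ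
    (¬d¹ ∘ gap-occupied d∈ d-occ)
    (λ d⁴-occ → ¬d⁵ (gap-occupied (↻-∈-dirs 4 d∈) d⁴-occ (subst Occupied (sym (↻-period d∈)) d-occ)))

  absorbs-near : ∀ {c} → (∀ {e} → e ∈ dirs → Occupied e → Near c e) → Absorbs B (m ⊕ c) m
  absorbs-near near x x∈B (inj₁ refl) = ⊥-elim (m∉B x∈B)
  absorbs-near near x x∈B (inj₂ adj) =
    let e , e∈ , x≡m⊕e = Adj-decompose m x adj
    in [ (λ e≡c → inj₁ (trans x≡m⊕e (cong (m ⊕_) e≡c))) ,
         (λ c~e → inj₂ (subst (Adj _) (sym x≡m⊕e) (Adj-⊕⁺ m c~e))) ]′
       (near e∈ (subst (_∈ B) x≡m⊕e x∈B))

  misses-or-absorbed : Misses B m ⊎ ∃[ c ] (c ∈ B × Absorbs B c m)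
  misses-or-absorbed with any? occupied? dirs
  ... | no none = inj₁ misses
    where
    misses : Misses B m
    misses x x∈B (inj₁ refl) = m∉B x∈B
    misses x x∈B (inj₂ adj) =
      let d , d∈ , x≡m⊕d = Adj-decompose m x adj in none (lose d∈ (subst (_∈ B) x≡m⊕d x∈B))
  ... | yes some =
    let d , d∈ , d-occ = find some
        c , c∈ , c-occ , near = find-arc-centre d∈ d-occ
    in inj₂ (m ⊕ c , c-occ , absorbs-near near)

absorbing-centre : ∀ {B} → IsRegular B → ∀ m → Misses B m ⊎ ∃[ c ] (c ∈ B × Absorbs B c m)
absorbing-centre {B} regular m with m ∈? B
... | yes m∈B = inj₂ (m , m∈B , λ _ _ x∈m → x∈m)
... | no m∉B  = AroundNonBoardCell.misses-or-absorbed B regular m m∉B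

CoveredBy : List Cell → Cell → Set
CoveredBy cs x = ∃[ m ] (m ∈ cs × InMaxFragment m x)

centres-into-board : ∀ {B} → IsRegular B → ∀ cs →
  ∃[ cs′ ] (All (_∈ B) cs′ × length cs′ ≤ length cs × (∀ x → x ∈ B → CoveredBy cs x → CoveredBy cs′ x))
centres-into-board regular [] = [] , [] , z≤n , λ _ _ ()
centres-into-board {B} regular (m ∷ cs) with centres-into-board regular cs | absorbing-centre regular m
... | cs′ , cs′⊆B , shorter , covered | inj₁ misses =
  cs′ , cs′⊆B , ℕ.m≤n⇒m≤1+n shorter , covered′
  where
  covered′ : ∀ x → x ∈ B → CoveredBy (m ∷ cs) x → CoveredBy cs′ x
  covered′ x x∈B (_ , here refl , x∈m)  = ⊥-elim (misses x x∈B x∈m)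
  covered′ x x∈B (m′ , there m′∈ , x∈m′) = covered x x∈B (m′ , m′∈ , x∈m′)
... | cs′ , cs′⊆B , shorter , covered | inj₂ (c , c∈B , absorbs) =
  c ∷ cs′ , c∈B ∷ cs′⊆B , s≤s shorter , covered′
  where
  covered′ : ∀ x → x ∈ B → CoveredBy (m ∷ cs) x → CoveredBy (c ∷ cs′) x
  covered′ x x∈B (_ , here refl , x∈m)  = c , here refl , absorbs x x∈B x∈m
  covered′ x x∈B (m′ , there m′∈ , x∈m′) =
    let c′ , c′∈ , x∈c′ = covered x x∈B (m′ , m′∈ , x∈m′) in c′ , there c′∈ , x∈c′

CentredCover : List Cell → ℕ → Set
CentredCover B k = ∃[ cs ] (All (_∈ B) cs × length cs ≡ k × MaxCover B cs)

cover⇒centred-cover : ∀ {B cs} → IsRegular B → MaxCover B cs → ∃[ k ] (k ≤ length cs × CentredCover B k)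
cover⇒centred-cover {cs = cs} regular cover =
  let cs′ , cs′⊆B , shorter , covered = centres-into-board regular cs
  in length cs′ , shorter , cs′ , cs′⊆B , refl , λ x x∈B → covered x x∈B (cover x x∈B)

-- Partitions into stars

-- IsFragPartition B fs unfolds to Enumerates B (concat (map fragCells fs)).
Enumerates : ∀ {A : Set} → List A → List A → Set
Enumerates B xs = Unique xs × (∀ c → c ∈ xs → c ∈ B) × (∀ c → c ∈ B → c ∈ xs)

Enumerates-resp-↭ : ∀ {A : Set} {B xs ys : List A} → xs ↭ ys → Enumerates B xs → Enumerates B ys
Enumerates-resp-↭ {A} xs↭ys (unique , sound , complete) =
  ↭ₛ.Unique-resp-↭ (setoid A) (↭⇒↭ₛ xs↭ys) unique ,
  (λ c c∈ys → sound c (↭.∈-resp-↭ (↭-sym xs↭ys) c∈ys)) ,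
  (λ c c∈B → ↭.∈-resp-↭ xs↭ys (complete c c∈B))

∈-split : ∀ {A : Set} {x : A} {xs} → x ∈ xs → ∃[ ys ] (xs ↭ x ∷ ys)
∈-split {x = x} x∈xs =
  let ys , zs , xs≡ = ∈-∃++ x∈xs in ys ++ zs , ↭-trans (↭-reflexive xs≡) (↭.shift x ys zs)

filter-split : ∀ {A : Set} {P : A → Set} (P? : ∀ x → Dec (P x)) xs →
  xs ↭ filter P? xs ++ filter (¬? ∘ P?) xs
filter-split {A} P? xs =
  subst (λ (ys , zs) → xs ↭ ys ++ zs) (List.partition-defn P? xs)
        (↭ₛ⇒↭ (↭ₛ.partition-↭ (setoid A) P? xs))

-- Unlike a fragment, a star may have no leaves.
record Star : Set where
  constructor star
  field
    centre   : Cell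
    leaves   : List Cell
    adjacent : All (Adj centre) leaves

starCells : Star → List Cell
starCells (star c ls _) = c ∷ ls

cellsOf : List Star → List Cell
cellsOf ss = concat (map starCells ss)

cellsOf-↭ : ∀ {ss ss′} → ss ↭ ss′ → cellsOf ss ↭ cellsOf ss′
cellsOf-↭ _↭_.refl        = ↭-refl
cellsOf-↭ (prep s p)      = ↭.++⁺ˡ (starCells s) (cellsOf-↭ p)
cellsOf-↭ (swap s t p)    =
  ↭-trans (↭.shifts (starCells s) (starCells t))
          (↭.++⁺ˡ (starCells t) (↭.++⁺ˡ (starCells s) (cellsOf-↭ p)))
cellsOf-↭ (_↭_.trans p q) = ↭-trans (cellsOf-↭ p) (cellsOf-↭ q)

∈-cellsOf⁻ : ∀ {x} ss → x ∈ cellsOf ss → ∃[ t ] ∃[ rest ] (ss ↭ t ∷ rest × x ∈ starCells t)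
∈-cellsOf⁻ ss x∈ with ∈-concat⁻′ (map starCells ss) x∈
... | _ , x∈t , t∈ with ∈-map⁻ starCells t∈
...   | t , t∈ss , refl = let rest , ss↭ = ∈-split t∈ss in t , rest , ss↭ , x∈t

IsSingleton : Star → Set
IsSingleton s = Star.leaves s ≡ []

singleton? : ∀ s → Dec (IsSingleton s)
singleton? (star _ []      _) = yes refl
singleton? (star _ (_ ∷ _) _) = no λ ()

singletonWeight : Star → ℕ
singletonWeight (star _ []      _) = 1
singletonWeight (star _ (_ ∷ _) _) = 0

singletons : List Star → ℕ
singletons ss = sum (map singletonWeight ss)

singletons-++ : ∀ ss ss′ → singletons (ss ++ ss′) ≡ singletons ss + singletons ss′
singletons-++ ss ss′ =
  trans (cong sum (List.map-++ singletonWeight ss ss′)) (sum-++ (map singletonWeight ss) _)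

singletons-↭ : ∀ {ss ss′} → ss ↭ ss′ → singletons ss ≡ singletons ss′
singletons-↭ = sum-↭ ∘ ↭.map⁺ singletonWeight

-- The leafless star c joins the star t of its neighbour d: as a leaf of t's centre, as the
-- third cell of the new star centred at a lone leaf d, or as the centre of the new star {c, d}.
merge-singleton : ∀ {c d} t rest → Adj c d → d ∈ starCells t →
  ∃[ news ] (c ∷ cellsOf (t ∷ rest) ↭ cellsOf (news ++ rest) × length news ≤ 2 × singletons news ≡ 0)
merge-singleton {c} (star e ls e~ls) rest c~d (here refl) =
  star e (c ∷ ls) (Adj-sym c e c~d ∷ e~ls) ∷ [] , swap c e ↭-refl , s≤s z≤n , refl
merge-singleton {c} {d} (star e ls e~ls) rest c~d (there d∈ls) with ∈-split d∈ls
... | [] , ls↭d with ↭.All-resp-↭ ls↭d e~ls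
...   | e~d ∷ [] =
  star d (e ∷ c ∷ []) (Adj-sym e d e~d ∷ Adj-sym c d c~d ∷ []) ∷ [] , recentre , s≤s z≤n , refl
  where
  open PermutationReasoning
  R = cellsOf rest
  recentre : c ∷ e ∷ ls ++ R ↭ d ∷ e ∷ c ∷ R
  recentre = begin
    c ∷ e ∷ ls ++ R   ↭⟨ prep c (prep e (↭.++⁺ʳ R ls↭d)) ⟩
    c ∷ e ∷ d ∷ R     ↭⟨ swap c e ↭-refl ⟩
    e ∷ c ∷ d ∷ R     ↭⟨ prep e (swap c d ↭-refl) ⟩
    e ∷ d ∷ c ∷ R     ↭⟨ swap e d ↭-refl ⟩
    d ∷ e ∷ c ∷ R     ∎
merge-singleton {c} {d} (star e ls e~ls) rest c~d (there d∈ls)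
  | y ∷ ys , ls↭dyys with ↭.All-resp-↭ ls↭dyys e~ls
... | _ ∷ e~yys =
  star c (d ∷ []) (c~d ∷ []) ∷ star e (y ∷ ys) e~yys ∷ [] , split-off , ℕ.≤-refl , refl
  where
  open PermutationReasoning
  R = cellsOf rest
  split-off : c ∷ e ∷ ls ++ R ↭ c ∷ d ∷ e ∷ y ∷ ys ++ R
  split-off = begin
    c ∷ e ∷ ls ++ R          ↭⟨ prep c (prep e (↭.++⁺ʳ R ls↭dyys)) ⟩
    c ∷ e ∷ d ∷ y ∷ ys ++ R  ↭⟨ prep c (swap e d ↭-refl) ⟩
    c ∷ d ∷ e ∷ y ∷ ys ++ R  ∎

singleton-step : ∀ {B} → IsBoard B → ∀ ss → Enumerates B (cellsOf ss) → Any IsSingleton ss →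
  ∃[ ss′ ] (cellsOf ss ↭ cellsOf ss′ × length ss′ ≤ length ss × singletons ss′ < singletons ss)
singleton-step board ss (_ , sound , complete) some with find some
... | star c .[] [] , s∈ss , refl with ∈-split s∈ss
... | rest , ss↭ with board c (sound c (↭.∈-resp-↭ (↭-sym (cellsOf-↭ ss↭)) (here refl)))
... | d , d∈B , c~d with ↭.∈-resp-↭ (cellsOf-↭ ss↭) (complete d d∈B)
... | here refl = ⊥-elim (Adj-irrefl c c~d)
... | there d∈rest with ∈-cellsOf⁻ rest d∈rest
... | t , rest′ , rest↭ , d∈t with merge-singleton t rest′ c~d d∈t
... | news , merged , ≤2 , no-singletons = news ++ rest′ , cells , shorter , fewer
  where
  open ℕ.≤-Reasoning
  ss↭′ : ss ↭ star c [] [] ∷ t ∷ rest′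
  ss↭′ = ↭-trans ss↭ (prep _ rest↭)
  cells : cellsOf ss ↭ cellsOf (news ++ rest′)
  cells = ↭-trans (cellsOf-↭ ss↭′) merged
  shorter : length (news ++ rest′) ≤ length ss
  shorter = begin
    length (news ++ rest′)       ≡⟨ List.length-++ news ⟩
    length news + length rest′   ≤⟨ ℕ.+-monoˡ-≤ (length rest′) ≤2 ⟩
    2 + length rest′             ≡⟨ sym (↭.↭-length ss↭′) ⟩
    length ss                    ∎
  fewer : singletons (news ++ rest′) < singletons ss
  fewer = begin-strict
    singletons (news ++ rest′)              ≡⟨ singletons-++ news rest′ ⟩
    singletons news + singletons rest′      ≡⟨ cong (_+ singletons rest′) no-singletons ⟩
    singletons rest′                        <⟨ s≤s (ℕ.m≤n+m _ (singletonWeight t)) ⟩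
    singletons (star c [] [] ∷ t ∷ rest′)  ≡⟨ sym (singletons-↭ ss↭′) ⟩
    singletons ss                           ∎

toFragments : ∀ ss → All (¬_ ∘ IsSingleton) ss →
  ∃[ fs ] (concat (map fragCells fs) ≡ cellsOf ss × length fs ≡ length ss)
toFragments [] [] = [] , refl , refl
toFragments (star c [] _ ∷ ss) (non-singleton ∷ _) = ⊥-elim (non-singleton refl)
toFragments (star c (l ∷ ls) (a ∷ as) ∷ ss) (_ ∷ non-singletons) =
  let fs , cells , len = toFragments ss non-singletons
  in frag c l ls a as ∷ fs , cong ((c ∷ l ∷ ls) ++_) cells , cong suc len

stars⇒partition : ∀ {B} → IsBoard B → ∀ ss → Acc _<_ (singletons ss) → Enumerates B (cellsOf ss) →
  ∃[ fs ] (IsFragPartition B fs × length fs ≤ length ss)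
stars⇒partition board ss (acc smaller) enum with any? singleton? ss
... | yes some =
  let ss′ , cells , shorter , fewer = singleton-step board ss enum some
      fs , partition , fs≤ = stars⇒partition board ss′ (smaller fewer) (Enumerates-resp-↭ cells enum)
  in fs , partition , ℕ.≤-trans fs≤ shorter
... | no none =
  let fs , cells , len = toFragments ss (All.¬Any⇒All¬ ss none)
  in fs , subst (Enumerates _) (sym cells) enum , ℕ.≤-reflexive len

far-adjacent : ∀ {c cs rest} → (∀ x → x ∈ rest → ∃[ c′ ] (c′ ∈ c ∷ cs × Adj c′ x)) →
  ∀ x → x ∈ filter (¬? ∘ adj? c) rest → ∃[ c′ ] (c′ ∈ cs × Adj c′ x)
far-adjacent {c} adjacent x x∈far with ∈-filter⁻ (¬? ∘ adj? c) x∈far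
... | x∈rest , ¬c~x with adjacent x x∈rest
...   | _ , here refl , c~x      = ⊥-elim (¬c~x c~x)
...   | c′ , there c′∈cs , c′~x = c′ , c′∈cs , c′~x

greedy-stars : ∀ cs rest → (∀ x → x ∈ rest → ∃[ c ] (c ∈ cs × Adj c x)) →
  ∃[ ss ] (cellsOf ss ↭ cs ++ rest × length ss ≡ length cs)
greedy-stars [] [] _ = [] , ↭-refl , refl
greedy-stars [] (x ∷ _) adjacent with adjacent x (here refl)
... | _ , () , _
greedy-stars (c ∷ cs) rest adjacent with greedy-stars cs (filter (¬? ∘ adj? c) rest) (far-adjacent adjacent)
... | ss , cells , len = star c near (All.all-filter (adj? c) rest) ∷ ss , prep c cells′ , cong suc len
  where
  open PermutationReasoning
  near = filter (adj? c) rest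
  far = filter (¬? ∘ adj? c) rest
  cells′ : near ++ cellsOf ss ↭ cs ++ rest
  cells′ = begin
    near ++ cellsOf ss   ↭⟨ ↭.++⁺ˡ near cells ⟩
    near ++ cs ++ far    ↭⟨ ↭.shifts near cs ⟩
    cs ++ near ++ far    ↭⟨ ↭.++⁺ˡ cs (↭-sym (filter-split (adj? c) rest)) ⟩
    cs ++ rest           ∎

centred-cover⇒stars : ∀ {B k} → CentredCover B k → ∃[ ss ] (Enumerates B (cellsOf ss) × length ss ≤ k)
centred-cover⇒stars {B} (cs , cs⊆B , refl , cover) =
  let ss , cells , len = greedy-stars centres others others-adjacent
  in ss , Enumerates-resp-↭ (↭-sym cells) enumerates ,
     ℕ.≤-trans (ℕ.≤-reflexive len) (List.length-deduplicate _≟ᶜ_ cs)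
  where
  centres = deduplicate _≟ᶜ_ cs
  cells = deduplicate _≟ᶜ_ B
  others = filter (λ x → ¬? (x ∈? centres)) cells

  others-adjacent : ∀ x → x ∈ others → ∃[ c ] (c ∈ centres × Adj c x)
  others-adjacent x x∈ with ∈-filter⁻ (λ x → ¬? (x ∈? centres)) {xs = cells} x∈
  ... | x∈cells , x∉centres with cover x (∈-deduplicate⁻ _≟ᶜ_ B x∈cells)
  ...   | m , m∈cs , inj₁ refl = ⊥-elim (x∉centres (∈-deduplicate⁺ _≟ᶜ_ m∈cs))
  ...   | m , m∈cs , inj₂ m~x  = m , ∈-deduplicate⁺ _≟ᶜ_ m∈cs , m~x

  enumerates : Enumerates B (centres ++ others)
  enumerates = unique , sound , complete
    where
    unique : Unique (centres ++ others)
    unique = Unique.++⁺ (Unique.deduplicate-! _≟ᶜ_ cs) (Unique.filter⁺ _ (Unique.deduplicate-! _≟ᶜ_ B))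
      (λ (x∈centres , x∈others) → proj₂ (∈-filter⁻ _ {xs = cells} x∈others) x∈centres)
    sound : ∀ x → x ∈ centres ++ others → x ∈ B
    sound x x∈ = [ (λ x∈centres → All.lookup cs⊆B (∈-deduplicate⁻ _≟ᶜ_ cs x∈centres)) ,
                   (λ x∈others → ∈-deduplicate⁻ _≟ᶜ_ B (proj₁ (∈-filter⁻ _ {xs = cells} x∈others))) ]′
                 (∈-++⁻ centres x∈)
    complete : ∀ x → x ∈ B → x ∈ centres ++ others
    complete x x∈B with x ∈? centres
    ... | yes x∈centres = ∈-++⁺ˡ x∈centres
    ... | no x∉centres  = ∈-++⁺ʳ centres (∈-filter⁺ _ (∈-deduplicate⁺ _≟ᶜ_ x∈B) x∉centres)

centred-cover⇒partition : ∀ {B k} → IsBoard B → CentredCover B k →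
  ∃[ fs ] (IsFragPartition B fs × length fs ≤ k)
centred-cover⇒partition board centred =
  let ss , enum , ss≤ = centred-cover⇒stars centred
      fs , partition , fs≤ = stars⇒partition board ss (<-wellFounded _) enum
  in fs , partition , ℕ.≤-trans fs≤ ss≤

fragment⊆max-fragment : ∀ f {x} → x ∈ fragCells f → InMaxFragment (Fragment.centre f) x
fragment⊆max-fragment (frag c l ls a as) (here refl)         = inj₁ refl
fragment⊆max-fragment (frag c l ls a as) (there (here refl)) = inj₂ a
fragment⊆max-fragment (frag c l ls a as) (there (there x∈))  = inj₂ (All.lookup as x∈)

partition⇒centred-cover : ∀ {B} fs → IsFragPartition B fs → CentredCover B (length fs)
partition⇒centred-cover {B} fs (_ , sound , complete) =
  map Fragment.centre fs , All.map⁺ (All.tabulate centre∈B) , List.length-map Fragment.centre fs , cover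
  where
  centre∈B : ∀ {f} → f ∈ fs → Fragment.centre f ∈ B
  centre∈B f∈fs = sound _ (∈-concat⁺′ (here refl) (∈-map⁺ fragCells f∈fs))
  cover : MaxCover B (map Fragment.centre fs)
  cover x x∈B with ∈-concat⁻′ (map fragCells fs) (complete x x∈B)
  ... | _ , x∈f , f∈ with ∈-map⁻ fragCells f∈
  ...   | f , f∈fs , refl = Fragment.centre f , ∈-map⁺ Fragment.centre f∈fs , fragment⊆max-fragment f x∈f

-- Minimal centred covers

list-over? : ∀ {A : Set} (xs : List A) {P : List A → Set} → (∀ ys → Dec (P ys)) → ∀ k →
  Dec (∃[ ys ] (All (_∈ xs) ys × length ys ≡ k × P ys))
list-over? xs P? zero with P? []
... | yes p = yes ([] , [] , refl , p)
... | no ¬p = no λ { ([] , _ , _ , p) → ¬p p }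
list-over? xs P? (suc k) with any? (λ x → list-over? xs (P? ∘ (x ∷_)) k) xs
... | yes some =
  let x , x∈xs , ys , ys⊆xs , len , p = find some in yes (x ∷ ys , x∈xs ∷ ys⊆xs , cong suc len , p)
... | no none = no λ where
  (x ∷ ys , x∈xs ∷ ys⊆xs , len , p) → none (lose x∈xs (ys , ys⊆xs , ℕ.suc-injective len , p))

max-cover? : ∀ B cs → Dec (MaxCover B cs)
max-cover? B cs =
  map′ (λ all x x∈B → find (All.lookup all x∈B))
       (λ cover → All.tabulate λ {x} x∈B → let m , m∈cs , x∈m = cover x x∈B in lose m∈cs x∈m)
       (All.all? (λ x → any? (λ m → (x ≟ᶜ m) ⊎-dec adj? m x) cs) B)

centred-cover? : ∀ B k → Dec (CentredCover B k)
centred-cover? B = list-over? B (max-cover? B)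

least-witness : ∀ {P : ℕ → Set} → (∀ k → Dec (P k)) → ∀ {n} → P n → ∃[ k ] (P k × ∀ j → P j → k ≤ j)
least-witness P? {zero} p = zero , p , λ _ _ → z≤n
least-witness {P} P? {suc n} p with P? zero
... | yes p₀ = zero , p₀ , λ _ _ → z≤n
... | no ¬p₀ with least-witness {P ∘ suc} (P? ∘ suc) p
...   | k , pk , minimal = suc k , pk , λ where
          zero    p₀ → ⊥-elim (¬p₀ p₀)
          (suc j) pj → s≤s (minimal j pj)

mainTheorem12 : (B : List Cell) → IsBoard B → IsRegular B →
    ∃[ n ] (IsX B n × IsF B n)
mainTheorem12 B board regular
  with least-witness (centred-cover? B) (B , All.tabulate (λ x∈B → x∈B) , refl , λ x x∈B → x , x∈B , inj₁ refl)
... | n , centred@(cs , _ , |cs|≡n , cover) , minimal with centred-cover⇒partition board centred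
... | fs , partition , |fs|≤n =
  n , ((cs , cover , |cs|≡n) , x-minimal) , ((fs , partition , ℕ.≤-antisym |fs|≤n (f-minimal fs partition)) , f-minimal)
  where
  x-minimal : ∀ cs′ → MaxCover B cs′ → n ≤ length cs′
  x-minimal cs′ cover′ =
    let k , k≤ , centred′ = cover⇒centred-cover regular cover′ in ℕ.≤-trans (minimal k centred′) k≤
  f-minimal : ∀ fs′ → IsFragPartition B fs′ → n ≤ length fs′
  f-minimal fs′ partition′ = minimal _ (partition⇒centred-cover fs′ partition′)
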